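{- A properly colored digraph $(G,\sigma)$ is a BMG if and only if $(G,\sigma)$ is a color-sink-free qBMG.
   Context: Digraphs are finite and simple; $\sigma$ is proper if $\sigma(x)=\sigma(y)$ implies $xy,yx\notin E(G)$. $N(x,s)$ is the set of out-neighbours of $x$ of color $s$; $(G,\sigma)$ is color-sink-free if $N(x,s)\ne\emptyset$ for all $x\in V(G)$ and all $s\in\sigma(V(G))\setminus\{\sigma(x)\}$. All rooted trees are phylogenetic; $v\preceq_T u$ means $u$ is on the path from the root $\rho_T$ to $v$; $\mathrm{lca}_T$ is the least common ancestor. In a leaf-colored tree $(T,\sigma)$, a leaf $y$ is a best match of a leaf $x$ if $\sigma(x)\ne\sigma(y)$ and $\mathrm{lca}_T(x,y)\preceq_T\mathrm{lca}_T(x,y')$ for every leaf $y'$ with $\sigma(y')=\sigma(y)$. The BMG of $(T,\sigma)$ has vertex set $L(T)$, coloring $\sigma$, and arcs $xy$ for best matches $y$ of $x$; a vertex-colored digraph is a BMG if it equals the BMG of some leaf-colored tree. A truncation map $u\colon L(T)\times S\to V(T)$ (with $\sigma(L(T))\subseteq S$) sends $(x,s)$ to a vertex on the path from $\rho_T$ to $x$, with $u(x,\sigma(x))=x$; $y$ is a quasi-best match of $x$ if it is a best match of $x$ and $\mathrm{lca}_T(x,y)\preceq_T u(x,\sigma(y))$. The qBMG of $(T,\sigma,u)$ is the vertex-colored digraph on $L(T)$ with arcs $xy$ for quasi-best matches $y$ of $x$; a vertex-colored digraph is a qBMG if it is the qBMG of some $(T,\sigma,u)$. -}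

module Defs where

open import Data.Nat using (ℕ; zero; suc)
open import Data.Fin using (Fin)
open import Data.Bool using (Bool; true; false)
open import Data.Product using (Σ; ∃; ∃₂; _×_; _,_)
open import Relation.Binary.PropositionalEquality using (_≡_; _≢_)
open import Relation.Nullary using (¬_)
open import Function.Bundles using (_⇔_)

-- A finite simple digraph: arc relation given as a Boolean matrix,
-- without loops (no multi-arcs by construction).
record Digraph (n : ℕ) : Set where
  field
    arc      : Fin n → Fin n → Bool
    loopless : ∀ x → arc x x ≡ false
open Digraph public

Arc : ∀ {n} → Digraph n → Fin n → Fin n → Set
Arc G x y = arc G x y ≡ true

Proper : ∀ {n c} → Digraph n → (Fin n → Fin c) → Set
Proper {n} G σ = ∀ (x y : Fin n) → σ x ≡ σ y → ¬ Arc G x y × ¬ Arc G y x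

ColorSinkFree : ∀ {n c} → Digraph n → (Fin n → Fin c) → Set
ColorSinkFree {n} {c} G σ =
  ∀ (x : Fin n) (s : Fin c) → (∃ λ z → σ z ≡ s) → s ≢ σ x →
    ∃ λ y → Arc G x y × σ y ≡ s

iter : ∀ {A : Set} → (A → A) → ℕ → A → A
iter f zero    a = a
iter f (suc k) a = f (iter f k a)

-- A rooted tree on vertex set Fin m, given by a parent map (the root is
-- its own parent) such that every vertex reaches the root; leaves are
-- labelled injectively by Fin n, the labelled vertices are exactly the
-- childless ones, and every inner vertex has at least two children.
record Tree (n : ℕ) : Set where
  field
    size   : ℕ
    root   : Fin size
    parent : Fin size → Fin size
    parent-root : parent root ≡ root
    reaches-root : ∀ v → ∃ λ k → iter parent k v ≡ root
    leaf   : Fin n → Fin size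
    leaf-injective : ∀ x y → leaf x ≡ leaf y → x ≡ y

  IsChild : Fin size → Fin size → Set
  IsChild w v = w ≢ root × parent w ≡ v

  field
    leaves-childless : ∀ v → (∃ λ x → leaf x ≡ v) ⇔ (∀ w → ¬ IsChild w v)
    phylogenetic : ∀ v → (∀ x → leaf x ≢ v) →
      ∃₂ λ w w' → w ≢ w' × IsChild w v × IsChild w' v

  _⪯_ : Fin size → Fin size → Set
  v ⪯ u = ∃ λ k → iter parent k v ≡ u

  IsLCA : Fin size → Fin size → Fin size → Set
  IsLCA a b w = a ⪯ w × b ⪯ w × (∀ w' → a ⪯ w' → b ⪯ w' → w ⪯ w')
open Tree public

module _ {n c : ℕ} (T : Tree n) (σ : Fin n → Fin c) where
  BestMatch : Fin n → Fin n → Set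
  BestMatch x y = σ x ≢ σ y ×
    (∀ y' → σ y' ≡ σ y → ∀ w w' →
       IsLCA T (leaf T x) (leaf T y) w → IsLCA T (leaf T x) (leaf T y') w' →
       _⪯_ T w w')

  record Truncation : Set where
    field
      tmap : Fin n → Fin c → Fin (size T)
      on-path : ∀ x s → _⪯_ T (leaf T x) (tmap x s)
      own-color : ∀ x → tmap x (σ x) ≡ leaf T x
  open Truncation public

  QuasiBestMatch : Truncation → Fin n → Fin n → Set
  QuasiBestMatch u x y = BestMatch x y ×
    (∀ w → IsLCA T (leaf T x) (leaf T y) w → _⪯_ T w (tmap u x (σ y)))

IsBMG : ∀ {n c} → Digraph n → (Fin n → Fin c) → Set
IsBMG {n} G σ = Σ (Tree n) λ T → ∀ x y → Arc G x y ⇔ BestMatch T σ x y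

IsQBMG : ∀ {n c} → Digraph n → (Fin n → Fin c) → Set
IsQBMG {n} G σ = Σ (Tree n) λ T → Σ (Truncation T σ) λ u →
  ∀ x y → Arc G x y ⇔ QuasiBestMatch T σ u x y

-- In the tree of a BMG, every leaf x has, for every other colour s that occurs, a best match of
-- colour s: any leaf of colour s below the least ancestor of x that has a leaf of colour s below it.
-- Truncating every foreign colour at the root then makes every best match quasi-best, so a BMG is a
-- colour-sink-free qBMG. Conversely, in a colour-sink-free qBMG, x has a quasi-best match y₀ of the
-- colour of any best match y, and lca(x, y) ⪯ lca(x, y₀) ⪯ u(x, σ y) makes y quasi-best as well,
-- so the qBMG is the BMG of the same tree.
module Submission where

open import Defs
open import Data.Nat using (ℕ; zero; suc; _+_; _∸_; _≤_; _<_; s≤s)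
open import Data.Nat.Properties using (anyUpTo?; ≮⇒≥; ≤-total; m∸n+n≡m; n<1+n)
open import Data.Nat.Induction using (<-rec)
open import Data.Fin using (Fin; _≟_)
open import Data.Fin.Properties using (any?)
open import Data.Product using (∃; _×_; _,_; proj₁; proj₂; uncurry)
open import Data.Sum using (inj₁; inj₂)
open import Data.Empty using (⊥-elim)
open import Function using (_∘_)
open import Function.Bundles using (_⇔_; mk⇔; Equivalence)
open import Relation.Nullary using (Dec; yes; no)
open import Relation.Nullary.Decidable using (map′; _×-dec_)
open import Relation.Unary using (Pred; Decidable)
open import Relation.Binary.PropositionalEquality
  using (_≡_; _≢_; refl; sym; trans; cong; subst; module ≡-Reasoning)

open Equivalence using (to; from)

module _ {p} {P : Pred ℕ p} (P? : Decidable P) where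

  Least : ℕ → Set p
  Least j = P j × (∀ i → P i → j ≤ i)

  least-witness : ∀ k → P k → ∃ Least
  least-witness = <-rec (λ k → P k → ∃ Least) step
    where
    step : ∀ k → (∀ {j} → j < k → P j → ∃ Least) → P k → ∃ Least
    step k below pk with anyUpTo? P? k
    ... | yes (j , j<k , pj) = below j<k pj
    ... | no none            = k , pk , λ _ pi → ≮⇒≥ (λ i<k → none (_ , i<k , pi))

iter-+ : ∀ {A : Set} (f : A → A) m n a → iter f (m + n) a ≡ iter f m (iter f n a)
iter-+ f zero    n a = refl
iter-+ f (suc m) n a = cong f (iter-+ f m n a)

iter-fixpoint : ∀ {A : Set} (f : A → A) {r} → f r ≡ r → ∀ k → iter f k r ≡ r
iter-fixpoint f fr≡r zero    = refl
iter-fixpoint f fr≡r (suc k) = trans (cong f (iter-fixpoint f fr≡r k)) fr≡r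

module Ancestry {n : ℕ} (T : Tree n) where

  private
    V : Set
    V = Fin (size T)

    ancestor : ℕ → V → V
    ancestor = iter (parent T)

    _≼_ : V → V → Set
    _≼_ = _⪯_ T

  ≼-trans : ∀ {a b c} → a ≼ b → b ≼ c → a ≼ c
  ≼-trans {a} (k , refl) (m , refl) = m + k , iter-+ (parent T) m k a

  ancestor-mono : ∀ a {j i} → j ≤ i → ancestor j a ≼ ancestor i a
  ancestor-mono a {j} {i} j≤i = i ∸ j , (begin
    ancestor (i ∸ j) (ancestor j a) ≡⟨ sym (iter-+ (parent T) (i ∸ j) j a) ⟩
    ancestor (i ∸ j + j) a          ≡⟨ cong (λ k → ancestor k a) (m∸n+n≡m j≤i) ⟩
    ancestor i a                    ∎)
    where open ≡-Reasoning

  ancestor-root : ∀ {v K k} → ancestor K v ≡ root T → K ≤ k → ancestor k v ≡ root T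
  ancestor-root {v} {K} {k} eK K≤k = begin
    ancestor k v                    ≡⟨ sym (proj₂ (ancestor-mono v K≤k)) ⟩
    ancestor (k ∸ K) (ancestor K v) ≡⟨ cong (ancestor (k ∸ K)) eK ⟩
    ancestor (k ∸ K) (root T)       ≡⟨ iter-fixpoint (parent T) (parent-root T) (k ∸ K) ⟩
    root T                          ∎
    where open ≡-Reasoning

  -- Beyond the K steps that lead v to the root, its ancestors repeat the root.
  ≼-dec : ∀ v u → Dec (v ≼ u)
  ≼-dec v u = map′ within all-steps (anyUpTo? (λ k → ancestor k v ≟ u) (suc K))
    where
    K = proj₁ (reaches-root T v)
    eK = proj₂ (reaches-root T v)

    within : (∃ λ k → k < suc K × ancestor k v ≡ u) → v ≼ u
    within (k , _ , e) = k , e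

    all-steps : v ≼ u → ∃ λ k → k < suc K × ancestor k v ≡ u
    all-steps (k , e) with ≤-total k K
    ... | inj₁ k≤K = k , s≤s k≤K , e
    ... | inj₂ K≤k = K , n<1+n K , trans eK (trans (sym (ancestor-root eK K≤k)) e)

  least-ancestor : ∀ {p} {P : Pred V p} → Decidable P → ∀ {a w} → a ≼ w → P w →
    ∃ λ m → a ≼ m × P m × (∀ {w'} → a ≼ w' → P w' → m ≼ w')
  least-ancestor {P = P} P? {a} (k , refl) pw
    with least-witness {P = λ j → P (ancestor j a)} (λ j → P? (ancestor j a)) k pw
  ... | j , pj , least =
    ancestor j a , (j , refl) , pj , λ { (i , refl) pw' → ancestor-mono a (least i pw') }

  lca-exists : ∀ a b → ∃ (IsLCA T a b)
  lca-exists a b with least-ancestor (≼-dec b) (reaches-root T a) (reaches-root T b)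
  ... | m , am , bm , least = m , am , bm , λ _ aw' bw' → least aw' bw'

module BestMatches {n c : ℕ} (T : Tree n) (σ : Fin n → Fin c) where
  open Ancestry T

  best-match-exists : ∀ x s → (∃ λ z → σ z ≡ s) → s ≢ σ x →
    ∃ λ y → BestMatch T σ x y × σ y ≡ s
  best-match-exists x s (z , σz≡s) s≢σx
    with least-ancestor (λ w → any? (λ y → (σ y ≟ s) ×-dec ≼-dec (leaf T y) w))
                        (reaches-root T (leaf T x)) (z , σz≡s , reaches-root T (leaf T z))
  ... | m , xm , (y , σy≡s , ym) , least =
    y , ((λ σx≡σy → s≢σx (trans (sym σy≡s) (sym σx≡σy))) , closest) , σy≡s
    where
    closest : ∀ y' → σ y' ≡ σ y → ∀ w w' → IsLCA T (leaf T x) (leaf T y) w →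
      IsLCA T (leaf T x) (leaf T y') w' → _⪯_ T w w'
    closest y' same w w' (_ , _ , w-least) (xw' , y'w' , _) =
      ≼-trans (w-least m xm ym) (least xw' (y' , trans same σy≡s , y'w'))

  root-tmap : Fin n → Fin c → Fin (size T)
  root-tmap x s with s ≟ σ x
  ... | yes _ = leaf T x
  ... | no _  = root T

  root-tmap-on-path : ∀ x s → _⪯_ T (leaf T x) (root-tmap x s)
  root-tmap-on-path x s with s ≟ σ x
  ... | yes _ = 0 , refl
  ... | no _  = reaches-root T (leaf T x)

  root-tmap-own-color : ∀ x → root-tmap x (σ x) ≡ leaf T x
  root-tmap-own-color x with σ x ≟ σ x
  ... | yes _    = refl
  ... | no σx≢σx = ⊥-elim (σx≢σx refl)

  root-tmap-foreign : ∀ {x s} → s ≢ σ x → root-tmap x s ≡ root T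
  root-tmap-foreign {x} {s} s≢σx with s ≟ σ x
  ... | yes s≡σx = ⊥-elim (s≢σx s≡σx)
  ... | no _     = refl

  rootTruncation : Truncation T σ
  rootTruncation = record
    { tmap = root-tmap ; on-path = root-tmap-on-path ; own-color = root-tmap-own-color }

  best⇒quasi-best-root : ∀ {x y} → BestMatch T σ x y → QuasiBestMatch T σ rootTruncation x y
  best⇒quasi-best-root bm@(σx≢σy , _) = bm , λ w _ →
    subst (_⪯_ T w) (sym (root-tmap-foreign (λ σy≡σx → σx≢σy (sym σy≡σx)))) (reaches-root T w)

  best⇒quasi-best : (u : Truncation T σ) → ∀ {x y y₀} → QuasiBestMatch T σ u x y₀ → σ y₀ ≡ σ y →
    BestMatch T σ x y → QuasiBestMatch T σ u x y
  best⇒quasi-best u {x} {y} {y₀} (_ , y₀-truncated) same bm@(_ , closest) = bm , λ w w-lca →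
    let (w₀ , w₀-lca) = lca-exists (leaf T x) (leaf T y₀) in
    ≼-trans (closest y₀ same w w₀ w-lca w₀-lca)
            (subst (λ s → _⪯_ T w₀ (tmap u x s)) same (y₀-truncated w₀ w₀-lca))

module _ {n c : ℕ} (G : Digraph n) (σ : Fin n → Fin c) where

  bmg⇒qbmg : IsBMG G σ → IsQBMG G σ
  bmg⇒qbmg (T , arc⇔bm) = T , rootTruncation , λ x y →
    mk⇔ (best⇒quasi-best-root ∘ to (arc⇔bm x y)) (from (arc⇔bm x y) ∘ proj₁)
    where open BestMatches T σ

  bmg⇒colorSinkFree : IsBMG G σ → ColorSinkFree G σ
  bmg⇒colorSinkFree (T , arc⇔bm) x s s-occurs s≢σx
    with BestMatches.best-match-exists T σ x s s-occurs s≢σx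
  ... | y , bm , σy≡s = y , from (arc⇔bm x y) bm , σy≡s

  qbmg×colorSinkFree⇒bmg : IsQBMG G σ → ColorSinkFree G σ → IsBMG G σ
  qbmg×colorSinkFree⇒bmg (T , u , arc⇔qbm) csf = T , λ x y →
    mk⇔ (proj₁ ∘ to (arc⇔qbm x y)) (from (arc⇔qbm x y) ∘ quasi-best x y)
    where
    quasi-best : ∀ x y → BestMatch T σ x y → QuasiBestMatch T σ u x y
    quasi-best x y bm@(σx≢σy , _) with csf x (σ y) (y , refl) (λ σy≡σx → σx≢σy (sym σy≡σx))
    ... | y₀ , arc₀ , σy₀≡σy = BestMatches.best⇒quasi-best T σ u (to (arc⇔qbm x y₀) arc₀) σy₀≡σy bm

theorem3 : ∀ {n c : ℕ} (G : Digraph n) (σ : Fin n → Fin c) → Proper G σ →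
    IsBMG G σ ⇔ (IsQBMG G σ × ColorSinkFree G σ)
theorem3 G σ _ =
  mk⇔ (λ bmg → bmg⇒qbmg G σ bmg , bmg⇒colorSinkFree G σ bmg) (uncurry (qbmg×colorSinkFree⇒bmg G σ))
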